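{- Let $j,k$ be positive integers with $\mathbf{B}_j^k$ finite and let $m = \max(\mathbf{B}_j^k)$. Suppose $\mathbf{B}_{j+1}^k = \{1\} \cup \{ n+1 : n \in \mathbf{B}_j^k\}$ and $\left\lfloor \sqrt[k]{m+1} \right\rfloor = \left\lfloor \sqrt[k]{m} \right\rfloor$. Then $\mathbf{B}_{j+2}^k = \{1\} \cup \{ n+1 : n \in \mathbf{B}_{j+1}^k\}$.
   Context: For positive integers $j,k$, a positive integer $n$ is called $(j,k)$-representable if $n = x_1^k + \cdots + x_j^k$ with all $x_i$ positive integers. $\mathbf{B}_j^k$ denotes the set of positive integers that are not $(j,k)$-representable. -}

module Defs where

open import Data.Nat using (ℕ; zero; suc; _+_; _^_; _≤_; _<_)
open import Data.Fin using (Fin)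
open import Data.Product using (Σ; ∃; _×_)
open import Data.Sum using (_⊎_)
open import Relation.Nullary using (¬_)
open import Relation.Binary.PropositionalEquality using (_≡_)
open import Function.Bundles using (_⇔_)

∑ : (j : ℕ) → (Fin j → ℕ) → ℕ
∑ zero    f = 0
∑ (suc j) f = f Fin.zero + ∑ j (λ i → f (Fin.suc i))

Representable : ℕ → ℕ → ℕ → Set
Representable j k n = Σ (Fin j → ℕ) λ x → (∀ i → 1 ≤ x i) × (∑ j (λ i → x i ^ k) ≡ n)

B : ℕ → ℕ → ℕ → Set
B j k n = (1 ≤ n) × ¬ Representable j k n

-- m is the maximum of B_j^k (so B_j^k is finite and m = max B_j^k)
IsMax : ℕ → ℕ → ℕ → Set
IsMax j k m = B j k m × (∀ n → B j k n → n ≤ m)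

IsFloorRoot : ℕ → ℕ → ℕ → Set
IsFloorRoot k n r = (r ^ k ≤ n) × (n < suc r ^ k)

ShiftEq : ℕ → ℕ → ℕ → Set
ShiftEq j' j k = ∀ n → B j' k n ⇔ ((n ≡ 1) ⊎ ∃ λ n' → B j k n' × (n ≡ suc n'))

-- If B_{j+1} = {1} ∪ (B_j + 1), then removing the first term x^k from a (j+2)-representation
-- of n + 1 leaves s ≥ j + 1 ≥ 2, and s ∈ B_{j+1} would follow from s − 1 ∈ B_j; so s − 1 is
-- j-representable and n = x^k + (s − 1) is (j+1)-representable. Adding a term 1^k gives the
-- converse inclusion.
module Submission where

open import Defs
open import Data.Nat using (ℕ; zero; suc; _+_; _^_; _≤_; z≤n; s≤s)
open import Data.Nat.Properties using (m^n>0; +-mono-≤; ≤-trans; ^-zeroˡ; +-suc; suc-injective)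
open import Data.Fin using (Fin)
open import Data.Product using (Σ; ∃; _×_; _,_; proj₂)
open import Data.Sum using (_⊎_; inj₁; inj₂)
open import Relation.Nullary using (¬_)
open import Relation.Binary.PropositionalEquality using (_≡_; refl; sym; trans; cong; subst)
open import Function.Bundles using (mk⇔; Equivalence)

∑-lowerBound : ∀ j (f : Fin j → ℕ) → (∀ i → 1 ≤ f i) → j ≤ ∑ j f
∑-lowerBound zero    f pos = z≤n
∑-lowerBound (suc j) f pos =
  +-mono-≤ (pos Fin.zero) (∑-lowerBound j (λ i → f (Fin.suc i)) (λ i → pos (Fin.suc i)))

^-positive : ∀ {x} k → 1 ≤ x → 1 ≤ x ^ k
^-positive {suc x} k _ = m^n>0 (suc x) k

Representable⇒≥ : ∀ {j} k {n} → Representable j k n → j ≤ n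
Representable⇒≥ {j} k (x , pos , eq) =
  subst (j ≤_) eq (∑-lowerBound j (λ i → x i ^ k) (λ i → ^-positive k (pos i)))

Representable-cons : ∀ {j} k {s x} → 1 ≤ x → Representable j k s → Representable (suc j) k (x ^ k + s)
Representable-cons {j} k {s} {x} 1≤x (xs , pos , eq) = ys , ys-pos , cong (x ^ k +_) eq
  where
  ys : Fin (suc j) → ℕ
  ys Fin.zero    = x
  ys (Fin.suc i) = xs i
  ys-pos : ∀ i → 1 ≤ ys i
  ys-pos Fin.zero    = 1≤x
  ys-pos (Fin.suc i) = pos i

Representable-uncons : ∀ {j} k {n} → Representable (suc j) k n →
  Σ ℕ λ x → 1 ≤ x × Σ ℕ λ s → Representable j k s × n ≡ x ^ k + s
Representable-uncons {j} k (xs , pos , eq) =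
  xs Fin.zero , pos Fin.zero , ∑ j (λ i → xs (Fin.suc i) ^ k) ,
  ((λ i → xs (Fin.suc i)) , (λ i → pos (Fin.suc i)) , refl) , sym eq

Representable-suc : ∀ {j} k {n} → Representable j k n → Representable (suc j) k (suc n)
Representable-suc k {n} r =
  subst (Representable _ k) (cong (_+ n) (^-zeroˡ k)) (Representable-cons k (s≤s z≤n) r)

1∈B-suc : ∀ {j k} → 1 ≤ j → B (suc j) k 1
1∈B-suc {k = k} (s≤s z≤n) = s≤s z≤n , λ r → 2+j≰1 (Representable⇒≥ k r)
  where
  2+j≰1 : ∀ {j} → ¬ suc (suc j) ≤ 1
  2+j≰1 (s≤s ())

B-pred : ∀ {j k n} → 1 ≤ n → B (suc j) k (suc n) → B j k n
B-pred {k = k} 1≤n (_ , ¬r) = 1≤n , λ r → ¬r (Representable-suc k r)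

ShiftEq-intro : ∀ {j k} → 1 ≤ j → (∀ {n} → B j k n → B (suc j) k (suc n)) → ShiftEq (suc j) j k
ShiftEq-intro {j} {k} 1≤j B-suc n = mk⇔ (to n) from
  where
  to : ∀ n → B (suc j) k n → (n ≡ 1) ⊎ ∃ λ n' → B j k n' × n ≡ suc n'
  to (suc zero)    _ = inj₁ refl
  to (suc (suc n)) b = inj₂ (suc n , B-pred {j} {k} (s≤s z≤n) b , refl)
  from : (n ≡ 1) ⊎ ∃ (λ n' → B j k n' × n ≡ suc n') → B (suc j) k n
  from (inj₁ refl)            = 1∈B-suc {j} {k} 1≤j
  from (inj₂ (n' , b , refl)) = B-suc b

ShiftEq⇒B-suc : ∀ {j k} → 1 ≤ j → ShiftEq (suc j) j k →
  ∀ {n} → B (suc j) k n → B (suc (suc j)) k (suc n)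
ShiftEq⇒B-suc {j} {k} 1≤j shift {n} (1≤n , ¬rn) = s≤s z≤n , ¬r
  where
  ¬r : ¬ Representable (suc (suc j)) k (suc n)
  ¬r r with Representable-uncons k r
  ... | x , 1≤x , suc s , rs , eq = proj₂ s+1∈B rs
    where
    1≤s : 1 ≤ s
    1≤s with Representable⇒≥ k rs
    ... | s≤s j≤s = ≤-trans 1≤j j≤s
    n≡x^k+s : n ≡ x ^ k + s
    n≡x^k+s = suc-injective (trans eq (+-suc (x ^ k) s))
    ¬rs : ¬ Representable j k s
    ¬rs r' = ¬rn (subst (Representable (suc j) k) (sym n≡x^k+s) (Representable-cons k 1≤x r'))
    s+1∈B : B (suc j) k (suc s)
    s+1∈B = Equivalence.from (shift (suc s)) (inj₂ (s , (1≤s , ¬rs) , refl))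
  ... | x , 1≤x , zero , rs , eq with Representable⇒≥ k rs
  ...   | ()

lemma10p16 : (j k m : ℕ) → 1 ≤ j → 1 ≤ k →
    IsMax j k m →
    ShiftEq (suc j) j k →
    (∃ λ r → IsFloorRoot k m r × IsFloorRoot k (suc m) r) →
    ShiftEq (suc (suc j)) (suc j) k
lemma10p16 j k m 1≤j _ _ shift _ = ShiftEq-intro {suc j} {k} (s≤s z≤n) (ShiftEq⇒B-suc {j} {k} 1≤j shift)
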